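{- Let $p\geq 5$ be a prime and $n$ a positive integer, and let $X_1,\dots,X_p\subseteq\mathbb{F}_p^{n}$ be such that every cycle $(x_1,\dots,x_p)\in X_1\times\dots\times X_p$ satisfies $x_1=x_2$. Then for every $j\in\{3,\dots,p\}$, the number of $j$-extendable pairs $(y,z)\in X_1\times X_j$ is at most $p^n$.
   Context: A cycle is a $p$-tuple $(x_1,\dots,x_p)\in (\mathbb{F}_p^{n})^p$ with $x_1+\dots+x_p=0$. For $j\in\{3,\dots,p\}$, a pair $(y,z)\in X_1\times X_j$ is called $j$-extendable if there exists a cycle $(x_1,\dots,x_p)\in X_1\times\dots\times X_p$ with $x_1=y$ and $x_j=z$. -}

module Defs where

open import Data.Nat using (ℕ; zero; suc; _<_; _≤_; s≤s; z≤n)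
open import Data.Nat.Properties using (≤-trans)
open import Data.Nat.Divisibility using (_∣_)
open import Data.Fin using (Fin; toℕ; fromℕ<)
open import Data.Vec using (Vec; lookup)
open import Data.List using (List; map; allFin)
open import Data.Nat.ListAction using (sum)
open import Data.Bool using (Bool; true)
open import Data.Product using (Σ; _×_)
open import Relation.Binary.PropositionalEquality using (_≡_)

-- 𝔽_p^n : vectors of length n with entries in 𝔽_p = Fin p (representatives 0..p-1).
Vecp : ℕ → ℕ → Set
Vecp p n = Vec (Fin p) n

-- A p-tuple of vectors, indexed 0..p-1 (index i stands for the paper's x_{i+1}).
Tuple : ℕ → ℕ → Set
Tuple p n = Fin p → Vecp p n

-- A cycle: x_1 + ... + x_p = 0 in 𝔽_p^n, i.e. in every coordinate k the sum of the
-- entries is 0 mod p.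
IsCycle : (p n : ℕ) → Tuple p n → Set
IsCycle p n x = (k : Fin n) → p ∣ sum (map (λ i → toℕ (lookup (x i) k)) (allFin p))

-- A family X_1,...,X_p of subsets of 𝔽_p^n (membership decidable, as for finite sets).
Family : ℕ → ℕ → Set
Family p n = Fin p → Vecp p n → Bool

_∈[_]_ : ∀ {p n} → Vecp p n → Fin p → Family p n → Set
v ∈[ i ] X = X i v ≡ true

InProduct : ∀ {p n} → Family p n → Tuple p n → Set
InProduct X x = ∀ i → x i ∈[ i ] X

idx₁ : ∀ {p} → 2 ≤ p → Fin p
idx₁ h = fromℕ< {0} (≤-trans (s≤s z≤n) h)

idx₂ : ∀ {p} → 2 ≤ p → Fin p
idx₂ h = fromℕ< {1} h

Extendable : ∀ {p n} (h : 2 ≤ p) → Family p n → Fin p → Vecp p n → Vecp p n → Set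
Extendable {p} {n} h X j y z =
  Σ (Tuple p n) λ x → IsCycle p n x × InProduct X x × x (idx₁ h) ≡ y × x j ≡ z

5≤⇒2≤ : ∀ {p} → 5 ≤ p → 2 ≤ p
5≤⇒2≤ h = ≤-trans (s≤s (s≤s z≤n)) h

module Submission where

-- Let (y, z) and (y′, z′) be j-extendable with y + z = y′ + z′, and let x be a cycle through
-- (y, z). Replacing x₁, x_j by y′, z′ keeps the sum, so it gives another cycle in X₁ × ⋯ × X_p,
-- whose first two entries therefore agree. Its second entry is still x₂ = x₁ = y, hence y′ = y
-- and then z′ = z. So (y, z) ↦ y + z is injective on j-extendable pairs, which are thus at
-- most |𝔽_p^n| = p^n in number.

open import Defs
open import Data.Nat using (ℕ; suc; _+_; _*_; _∸_; _%_; _/_; _≤_; _^_; NonZero; >-nonZero; s≤s; z≤n)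
open import Data.Nat.Properties using (+-assoc; +-comm; +-commutativeSemigroup; m+[n∸m]≡n; ≤-trans; ≰⇒>; _≤?_)
open import Data.Nat.DivMod using (_mod_; m≡m%n+[m/n]*n; m%n≤n; %-distribˡ-+; %-remove-+ʳ; m<n⇒m%n≡m)
open import Data.Nat.Divisibility using (_∣_; divides; m%n≡0⇒n∣m; n∣m⇒m%n≡0)
open import Data.Nat.ListAction using (sum)
open import Data.Nat.Primality using (Prime)
open import Algebra.Properties.CommutativeSemigroup +-commutativeSemigroup using (xy∙z≈zy∙x; xy∙z≈xz∙y)
open import Data.Fin using (Fin; _<_; zero; suc; toℕ; _≟_; funToFin; finToFun)
open import Data.Fin.Properties using (toℕ-fromℕ<; toℕ-injective; toℕ<n; suc-injective; finToFun-funToFin; pigeonhole; <⇒≢)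
open import Data.List using (List; length; map; tabulate; allFin)
open import Data.List.Properties using (map-tabulate; tabulate-cong)
import Data.List as List
open import Data.List.Membership.Propositional.Properties using (∈-lookup)
open import Data.List.Relation.Unary.All using (All)
import Data.List.Relation.Unary.All as All
open import Data.List.Relation.Unary.AllPairs using (_∷_)
open import Data.List.Relation.Unary.Unique.Propositional using (Unique)
open import Data.Vec using (lookup; zipWith)
open import Data.Vec.Properties using (lookup-zipWith)
open import Data.Vec.Relation.Binary.Pointwise.Extensional using (ext; Pointwise-≡⇒≡)
open import Data.Vec.Functional using (updateAt)
open import Data.Vec.Functional.Properties using (updateAt-updates; updateAt-minimal)
open import Relation.Nullary using (yes; no; contradiction)
open import Relation.Binary.PropositionalEquality using (_≡_; _≢_; refl; sym; trans; cong; cong₂; subst; module ≡-Reasoning)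
open import Data.Product using (_×_; _,_)
open import Function using (_∘_; const)

∑ : ∀ {m} → (Fin m → ℕ) → ℕ
∑ {m} F = sum (map F (allFin m))

sum-tabulate-modify : ∀ {m} (F G : Fin m → ℕ) (i : Fin m) → (∀ k → k ≢ i → G k ≡ F k) →
                      sum (tabulate G) + F i ≡ sum (tabulate F) + G i
sum-tabulate-modify {suc m} F G zero G≈F = begin
  (G zero + sum (tabulate (G ∘ suc))) + F zero
    ≡⟨ cong (λ t → (G zero + sum t) + F zero) (tabulate-cong (λ k → G≈F (suc k) λ ())) ⟩
  (G zero + sum (tabulate (F ∘ suc))) + F zero ≡⟨ xy∙z≈zy∙x (G zero) _ (F zero) ⟩
  (F zero + sum (tabulate (F ∘ suc))) + G zero ∎
  where open ≡-Reasoning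
sum-tabulate-modify {suc m} F G (suc i) G≈F = begin
  (G zero + sum (tabulate (G ∘ suc))) + F (suc i) ≡⟨ +-assoc (G zero) _ _ ⟩
  G zero + (sum (tabulate (G ∘ suc)) + F (suc i))
    ≡⟨ cong₂ _+_ (G≈F zero λ ())
             (sum-tabulate-modify (F ∘ suc) (G ∘ suc) i λ k k≢i → G≈F (suc k) (k≢i ∘ suc-injective)) ⟩
  F zero + (sum (tabulate (F ∘ suc)) + G (suc i)) ≡⟨ +-assoc (F zero) _ _ ⟨
  (F zero + sum (tabulate (F ∘ suc))) + G (suc i) ∎
  where open ≡-Reasoning

∑-modify : ∀ {m} (F G : Fin m → ℕ) (i : Fin m) → (∀ k → k ≢ i → G k ≡ F k) → ∑ G + F i ≡ ∑ F + G i
∑-modify {m} F G i G≈F = begin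
  ∑ G + F i                  ≡⟨ cong (λ t → sum t + F i) (map-tabulate (λ k → k) G) ⟩
  sum (tabulate G) + F i     ≡⟨ sum-tabulate-modify F G i G≈F ⟩
  sum (tabulate F) + G i     ≡⟨ cong (λ t → sum t + G i) (map-tabulate (λ k → k) F) ⟨
  ∑ F + G i ∎
  where open ≡-Reasoning

∑-modify₂ : ∀ {m} (F G : Fin m → ℕ) {i j : Fin m} → i ≢ j → (∀ k → k ≢ i → k ≢ j → G k ≡ F k) →
            ∑ G + (F i + F j) ≡ ∑ F + (G i + G j)
∑-modify₂ {m} F G {i} {j} i≢j G≈F = begin
  ∑ G + (F i + F j)  ≡⟨ cong (∑ G +_) (+-comm (F i) (F j)) ⟩
  ∑ G + (F j + F i)  ≡⟨ +-assoc (∑ G) (F j) (F i) ⟨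
  (∑ G + F j) + F i  ≡⟨ cong (λ t → (∑ G + t) + F i) (updateAt-minimal j i F (i≢j ∘ sym)) ⟨
  (∑ G + H j) + F i  ≡⟨ cong (_+ F i) (∑-modify H G j G≈H) ⟩
  (∑ H + G j) + F i  ≡⟨ xy∙z≈xz∙y (∑ H) (G j) (F i) ⟩
  (∑ H + F i) + G j  ≡⟨ cong (_+ G j) (∑-modify F H i (λ k k≢i → updateAt-minimal k i F k≢i)) ⟩
  (∑ F + H i) + G j  ≡⟨ cong (λ t → (∑ F + t) + G j) (updateAt-updates i F) ⟩
  (∑ F + G i) + G j  ≡⟨ +-assoc (∑ F) (G i) (G j) ⟩
  ∑ F + (G i + G j)  ∎
  where
  open ≡-Reasoning
  H : Fin m → ℕ
  H = updateAt F i (const (G i))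
  G≈H : ∀ k → k ≢ j → G k ≡ H k
  G≈H k k≢j with k ≟ i
  ... | yes refl = sym (updateAt-updates i F)
  ... | no k≢i   = trans (G≈F k k≢i k≢j) (sym (updateAt-minimal k i F k≢i))

d∣o+[d∸o%d] : ∀ o d .{{_ : NonZero d}} → d ∣ o + (d ∸ o % d)
d∣o+[d∸o%d] o d = divides (suc (o / d)) (begin
  o + (d ∸ o % d)                    ≡⟨ cong (_+ (d ∸ o % d)) (m≡m%n+[m/n]*n o d) ⟩
  (o % d + o / d * d) + (d ∸ o % d)  ≡⟨ xy∙z≈xz∙y (o % d) (o / d * d) (d ∸ o % d) ⟩
  (o % d + (d ∸ o % d)) + o / d * d  ≡⟨ cong (_+ o / d * d) (m+[n∸m]≡n (m%n≤n o d)) ⟩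
  d + o / d * d                      ∎)
  where open ≡-Reasoning

%-cancelʳ-+ : ∀ m n o d .{{_ : NonZero d}} → (m + o) % d ≡ (n + o) % d → m % d ≡ n % d
%-cancelʳ-+ m n o d eq = begin
  m % d                              ≡⟨ shift m ⟨
  ((m + o) % d + o′ % d) % d         ≡⟨ cong (λ t → (t + o′ % d) % d) eq ⟩
  ((n + o) % d + o′ % d) % d         ≡⟨ shift n ⟩
  n % d                              ∎
  where
  open ≡-Reasoning
  o′ = d ∸ o % d
  shift : ∀ m → ((m + o) % d + o′ % d) % d ≡ m % d
  shift m = begin
    ((m + o) % d + o′ % d) % d  ≡⟨ %-distribˡ-+ (m + o) o′ d ⟨
    (m + o + o′) % d            ≡⟨ cong (_% d) (+-assoc m o o′) ⟩
    (m + (o + o′)) % d          ≡⟨ %-remove-+ʳ m (d∣o+[d∸o%d] o d) ⟩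
    m % d                       ∎

%-cancelˡ-+ : ∀ o m n d .{{_ : NonZero d}} → (o + m) % d ≡ (o + n) % d → m % d ≡ n % d
%-cancelˡ-+ o m n d eq = %-cancelʳ-+ m n o d (begin
  (m + o) % d  ≡⟨ cong (_% d) (+-comm m o) ⟩
  (o + m) % d  ≡⟨ eq ⟩
  (o + n) % d  ≡⟨ cong (_% d) (+-comm o n) ⟩
  (n + o) % d  ∎)
  where open ≡-Reasoning

+≡+⇒%≡% : ∀ {m n a b} d .{{_ : NonZero d}} → a % d ≡ b % d → m + a ≡ n + b → m % d ≡ n % d
+≡+⇒%≡% {m} {n} {a} {b} d a≡b eq = %-cancelʳ-+ m n a d (begin
  (m + a) % d              ≡⟨ cong (_% d) eq ⟩
  (n + b) % d              ≡⟨ %-distribˡ-+ n b d ⟩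
  (n % d + b % d) % d      ≡⟨ cong (λ t → (n % d + t) % d) a≡b ⟨
  (n % d + a % d) % d      ≡⟨ %-distribˡ-+ n a d ⟨
  (n + a) % d              ∎)
  where open ≡-Reasoning

module _ {p n : ℕ} .{{_ : NonZero p}} where

  _⊕_ : Vecp p n → Vecp p n → Vecp p n
  y ⊕ z = zipWith (λ a b → (toℕ a + toℕ b) mod p) y z

  toℕ-⊕ : ∀ y z k → toℕ (lookup (y ⊕ z) k) ≡ (toℕ (lookup y k) + toℕ (lookup z k)) % p
  toℕ-⊕ y z k = trans (cong toℕ (lookup-zipWith _ k y z)) (toℕ-fromℕ< _)

  ⊕-≡⇒%-≡ : ∀ {y z y′ z′} → y ⊕ z ≡ y′ ⊕ z′ → ∀ k →
            (toℕ (lookup y k) + toℕ (lookup z k)) % p ≡ (toℕ (lookup y′ k) + toℕ (lookup z′ k)) % p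
  ⊕-≡⇒%-≡ {y} {z} {y′} {z′} eq k =
    trans (sym (toℕ-⊕ y z k)) (trans (cong (λ v → toℕ (lookup v k)) eq) (toℕ-⊕ y′ z′ k))

  ⊕-cancelˡ : ∀ y {z z′} → y ⊕ z ≡ y ⊕ z′ → z ≡ z′
  ⊕-cancelˡ y {z} {z′} eq = Pointwise-≡⇒≡ (ext λ k → toℕ-injective (begin
    toℕ (lookup z k)      ≡⟨ m<n⇒m%n≡m (toℕ<n (lookup z k)) ⟨
    toℕ (lookup z k) % p  ≡⟨ %-cancelˡ-+ (toℕ (lookup y k)) _ _ p (⊕-≡⇒%-≡ eq k) ⟩
    toℕ (lookup z′ k) % p ≡⟨ m<n⇒m%n≡m (toℕ<n (lookup z′ k)) ⟩
    toℕ (lookup z′ k)     ∎))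
    where open ≡-Reasoning

  IsCycle-replace₂ : ∀ {x w : Tuple p n} {i j : Fin p} → i ≢ j → (∀ k → k ≢ i → k ≢ j → w k ≡ x k) →
                     w i ⊕ w j ≡ x i ⊕ x j → IsCycle p n x → IsCycle p n w
  IsCycle-replace₂ {x} {w} {i} {j} i≢j w≈x ⊕-eq x-cycle c = m%n≡0⇒n∣m _ p (begin
    ∑ (column w) % p
      ≡⟨ +≡+⇒%≡% p (sym (⊕-≡⇒%-≡ ⊕-eq c)) (∑-modify₂ (column x) (column w) i≢j column-eq) ⟩
    ∑ (column x) % p  ≡⟨ n∣m⇒m%n≡0 _ p (x-cycle c) ⟩
    0                 ∎)
    where
    open ≡-Reasoning
    column : Tuple p n → Fin p → ℕ
    column v k = toℕ (lookup (v k) c)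
    column-eq : ∀ k → k ≢ i → k ≢ j → column w k ≡ column x k
    column-eq k k≢i k≢j = cong (λ v → toℕ (lookup v c)) (w≈x k k≢i k≢j)

InProduct-updateAt : ∀ {p n} {X : Family p n} {x : Tuple p n} {i : Fin p} {v : Vecp p n} →
                     InProduct X x → v ∈[ i ] X → InProduct X (updateAt x i (const v))
InProduct-updateAt {X = X} {x} {i} {v} x∈X v∈Xᵢ k with k ≟ i
... | yes refl = subst (λ u → u ∈[ i ] X) (sym (updateAt-updates i x)) v∈Xᵢ
... | no k≢i   = subst (λ u → u ∈[ k ] X) (sym (updateAt-minimal k i x k≢i)) (x∈X k)

Unique⇒lookup-injective : ∀ {A : Set} {xs : List A} → Unique xs →
                          ∀ i j → List.lookup xs i ≡ List.lookup xs j → i ≡ j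
Unique⇒lookup-injective (x∉xs ∷ u) zero    zero    eq = refl
Unique⇒lookup-injective (x∉xs ∷ u) zero    (suc j) eq = contradiction eq (All.lookup x∉xs (∈-lookup j))
Unique⇒lookup-injective (x∉xs ∷ u) (suc i) zero    eq = contradiction (sym eq) (All.lookup x∉xs (∈-lookup i))
Unique⇒lookup-injective (x∉xs ∷ u) (suc i) (suc j) eq = cong suc (Unique⇒lookup-injective u i j eq)

length≤-injectiveOn : ∀ {A : Set} {P : A → Set} {M} (f : A → Fin M) →
                      (∀ {a b} → P a → P b → f a ≡ f b → a ≡ b) →
                      ∀ {xs} → Unique xs → All P xs → length xs ≤ M
length≤-injectiveOn {M = M} f f-inj {xs} xs-unique pxs with length xs ≤? M
... | yes ≤M = ≤M
... | no ≰M with i , j , i<j , eq ← pigeonhole (≰⇒> ≰M) (f ∘ List.lookup xs) =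
  contradiction (Unique⇒lookup-injective xs-unique i j
                   (f-inj (All.lookup pxs (∈-lookup i)) (All.lookup pxs (∈-lookup j)) eq))
                (<⇒≢ i<j)

funToFin∘lookup-injective : ∀ {p n} (u v : Vecp p n) →
                            funToFin (lookup u) ≡ funToFin (lookup v) → u ≡ v
funToFin∘lookup-injective u v eq = Pointwise-≡⇒≡ (ext λ k → begin
  lookup u k                         ≡⟨ finToFun-funToFin (lookup u) k ⟨
  finToFun (funToFin (lookup u)) k   ≡⟨ cong (λ c → finToFun c k) eq ⟩
  finToFun (funToFin (lookup v)) k   ≡⟨ finToFun-funToFin (lookup v) k ⟩
  lookup v k                         ∎)
  where open ≡-Reasoning

module _ {p n : ℕ} .{{_ : NonZero p}} (h : 2 ≤ p) (X : Family p n)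
         (x₁≡x₂ : (x : Tuple p n) → IsCycle p n x → InProduct X x → x (idx₁ h) ≡ x (idx₂ h))
         {j : Fin p} (2≤j : 2 ≤ toℕ j) where

  private
    i₁ i₂ : Fin p
    i₁ = idx₁ h
    i₂ = idx₂ h

    i₁<i₂ : i₁ < i₂
    i₁<i₂ rewrite toℕ-fromℕ< (≤-trans (s≤s z≤n) h) | toℕ-fromℕ< h = s≤s z≤n

    i₁<j : i₁ < j
    i₁<j rewrite toℕ-fromℕ< (≤-trans (s≤s z≤n) h) = ≤-trans (s≤s z≤n) 2≤j

    i₂<j : i₂ < j
    i₂<j rewrite toℕ-fromℕ< h = 2≤j

  ⊕-injectiveOn-extendable : ∀ {y z y′ z′} → Extendable h X j y z → Extendable h X j y′ z′ →
                             y ⊕ z ≡ y′ ⊕ z′ → (y , z) ≡ (y′ , z′)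
  ⊕-injectiveOn-extendable {y} {z} {y′} {z′}
    (x , x-cycle , x∈X , refl , refl) (x′ , _ , x′∈X , refl , refl) eq =
    cong₂ _,_ y≡y′ (⊕-cancelˡ y (trans eq (cong (_⊕ z′) (sym y≡y′))))
    where
    open ≡-Reasoning
    w : Tuple p n
    w = updateAt (updateAt x i₁ (const y′)) j (const z′)
    w≈x : ∀ k → k ≢ i₁ → k ≢ j → w k ≡ x k
    w≈x k k≢i₁ k≢j = trans (updateAt-minimal k j _ k≢j) (updateAt-minimal k i₁ x k≢i₁)
    w₁≡y′ : w i₁ ≡ y′
    w₁≡y′ = trans (updateAt-minimal i₁ j _ (<⇒≢ i₁<j)) (updateAt-updates i₁ x)
    w-cycle : IsCycle p n w
    w-cycle = IsCycle-replace₂ (<⇒≢ i₁<j) w≈x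
                (trans (cong₂ _⊕_ w₁≡y′ (updateAt-updates j _)) (sym eq)) x-cycle
    w∈X : InProduct X w
    w∈X = InProduct-updateAt {X = X} (InProduct-updateAt {X = X} x∈X (x′∈X i₁)) (x′∈X j)
    y≡y′ : y ≡ y′
    y≡y′ = begin
      x i₁  ≡⟨ x₁≡x₂ x x-cycle x∈X ⟩
      x i₂  ≡⟨ w≈x i₂ (<⇒≢ i₁<i₂ ∘ sym) (<⇒≢ i₂<j) ⟨
      w i₂  ≡⟨ x₁≡x₂ w w-cycle w∈X ⟨
      w i₁  ≡⟨ w₁≡y′ ⟩
      x′ i₁ ∎

lemma3p1 : (p n : ℕ) → Prime p → (p≥5 : 5 ≤ p) → 1 ≤ n →
    (X : Family p n) →
    ((x : Tuple p n) → IsCycle p n x → InProduct X x →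
       x (idx₁ (5≤⇒2≤ p≥5)) ≡ x (idx₂ (5≤⇒2≤ p≥5))) →
    (j : Fin p) → 2 ≤ toℕ j →
    (ps : List (Vecp p n × Vecp p n)) → Unique ps →
    All (λ { (y , z) → (y ∈[ idx₁ (5≤⇒2≤ p≥5) ] X) × (z ∈[ j ] X)
                        × Extendable (5≤⇒2≤ p≥5) X j y z }) ps →
    length ps ≤ p ^ n
lemma3p1 p n _ p≥5 _ X x₁≡x₂ j 2≤j ps ps-unique ps-admissible =
  length≤-injectiveOn code code-injective ps-unique
    (All.map (λ { {y , z} (_ , _ , yz-ext) → yz-ext }) ps-admissible)
  where
  h : 2 ≤ p
  h = 5≤⇒2≤ p≥5
  instance
    p-nonZero : NonZero p
    p-nonZero = >-nonZero (≤-trans (s≤s z≤n) h)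
  ExtendablePair : Vecp p n × Vecp p n → Set
  ExtendablePair (y , z) = Extendable h X j y z
  code : Vecp p n × Vecp p n → Fin (p ^ n)
  code (y , z) = funToFin (lookup (y ⊕ z))
  code-injective : ∀ {a b} → ExtendablePair a → ExtendablePair b → code a ≡ code b → a ≡ b
  code-injective {y , z} {y′ , z′} yz-ext y′z′-ext eq =
    ⊕-injectiveOn-extendable h X x₁≡x₂ 2≤j yz-ext y′z′-ext
      (funToFin∘lookup-injective (y ⊕ z) (y′ ⊕ z′) eq)
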